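{- Let $G$ be a graph and $F$ an arbitrary forest of $G$. Orient and order the $h$ edges not in $F$ as $e_1<e_2<\cdots<e_h$. For each cycle $C$ of $G$, orient $C$ so that it traverses, in its given direction, the smallest edge $e_i$ (in this order) contained in $C$. Then the resulting cycle orientation configuration is geometric.
   Context: Graphs are finite and connected, possibly with parallel edges but without loops; cycles are simple (every cycle contains some edge outside the forest $F$). Edges have reference orientations (for the $e_i$, take the chosen orientation); an oriented cycle $C$ is identified with $\sum_{e\in C}\operatorname{sign}(C,e)e$ in the real vector space $C_1(G,\mathbb{R})$ with orthonormal basis $E(G)$, where $\operatorname{sign}(C,e)=\pm1$ according as $C$ traverses $e$ along or against its reference orientation; $H_1(G,\mathbb{R})$ is the span of all cycles. A cycle orientation configuration assigns an orientation to each cycle; it is geometric if there exists $\mathbf{w}\in H_1(G,\mathbb{R})$ with $\langle\mathbf{w},C\rangle>0$ for every cycle $C$ oriented as in the configuration. (The associated map from spanning trees to break divisors — orient each edge $f\notin T$ as in its fundamental cycle in $T+f$ and put a chip at its head — is called an edge ordering map.) -}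

module Defs where

open import Data.Nat using (ℕ; _≤_)
open import Data.Bool using (Bool; true; false; if_then_else_)
open import Data.Fin using (Fin; _≟_)
open import Data.Fin.Subset using (Subset; _∈_; _∉_)
open import Data.List using (List; []; _∷_; _++_; map; length; foldr; allFin)
open import Data.List.Relation.Unary.All using (All)
open import Data.List.Relation.Unary.Any using (Any)
open import Data.List.Relation.Unary.Unique.Propositional using (Unique)
open import Data.Product using (Σ; ∃; _×_; _,_; proj₁; proj₂)
open import Data.Empty using (⊥)
open import Data.Unit using (⊤)
open import Data.Rational using (ℚ; 0ℚ; 1ℚ; -_; _+_; _*_; _<_)
open import Relation.Binary.PropositionalEquality using (_≡_; _≢_)
open import Relation.Nullary using (¬_)
open import Relation.Nullary.Decidable using (⌊_⌋)

-- A finite graph: vertices Fin n, edges Fin m, each edge with a reference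
-- orientation src e → tgt e.  Parallel edges allowed, loops forbidden.
record Graph : Set where
  field
    n m   : ℕ
    src   : Fin m → Fin n
    tgt   : Fin m → Fin n
    noLoop : ∀ e → src e ≢ tgt e

module _ (G : Graph) where
  open Graph G

  -- a step: an edge together with a direction (true = along the reference orientation)
  Step : Set
  Step = Fin m × Bool

  stepTail : Step → Fin n
  stepTail (e , true)  = src e
  stepTail (e , false) = tgt e

  stepHead : Step → Fin n
  stepHead (e , true)  = tgt e
  stepHead (e , false) = src e

  IsWalk : Fin n → Fin n → List Step → Set
  IsWalk u v []       = u ≡ v
  IsWalk u v (s ∷ ss) = stepTail s ≡ u × IsWalk (stepHead s) v ss

  Connected : Set
  Connected = ∀ u v → ∃ λ W → IsWalk u v W

  Chain : List Step → Set
  Chain []             = ⊤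
  Chain (s ∷ [])       = ⊤
  Chain (s ∷ t ∷ ss)   = stepHead s ≡ stepTail t × Chain (t ∷ ss)

  IsCycle : List Step → Set
  IsCycle []       = ⊥
  IsCycle (s ∷ ss) =
    2 ≤ length (s ∷ ss)
    × Chain (s ∷ ss ++ s ∷ [])
    × Unique (map stepTail (s ∷ ss))
    × Unique (map proj₁ (s ∷ ss))

  IsForest : Subset m → Set
  IsForest F = ∀ C → IsCycle C → ¬ All (λ s → proj₁ s ∈ F) C

  Chain₁ : Set
  Chain₁ = Fin m → ℚ

  sumℚ : List ℚ → ℚ
  sumℚ = foldr _+_ 0ℚ

  signℚ : Bool → ℚ
  signℚ true  = 1ℚ
  signℚ false = - 1ℚ

  cycleVec : List Step → Chain₁
  cycleVec C e = sumℚ (map (λ s → if ⌊ proj₁ s ≟ e ⌋ then signℚ (proj₂ s) else 0ℚ) C)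

  ⟨_,_⟩ : Chain₁ → Chain₁ → ℚ
  ⟨ v , w ⟩ = sumℚ (map (λ e → v e * w e) (allFin m))

  -- membership in H₁(G,ℚ): a finite linear combination of cycles
  InH₁ : Chain₁ → Set
  InH₁ w = ∃ λ (L : List (ℚ × List Step)) →
             All (λ p → IsCycle (proj₂ p)) L
             × (∀ e → w e ≡ sumℚ (map (λ p → proj₁ p * cycleVec (proj₂ p) e) L))

  -- the orientation of C prescribed in the theorem: C traverses its smallest
  -- (w.r.t. ord) edge outside F along that edge's (chosen) reference orientation
  MinEdgeForward : Subset m → (Fin m → ℕ) → List Step → Set
  MinEdgeForward F ord C =
    Σ (Fin m) λ e → e ∉ F × Any (λ s → s ≡ (e , true)) C
      × All (λ s → proj₁ s ∉ F → ord e ≤ ord (proj₁ s)) C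

  Geometric : Subset m → (Fin m → ℕ) → Set
  Geometric F ord =
    ∃ λ (w : Chain₁) → InH₁ w ×
      (∀ C → IsCycle C → MinEdgeForward F ord C → 0ℚ < ⟨ w , cycleVec C ⟩)

module Submission where

-- Give the edges outside F the weights ε^{ord e}, where
-- ε = 1/(1+m), and the edges of F weight 0; call the resulting vector v.  On a
-- cycle C oriented as in the theorem, the smallest edge e outside F contributes
-- +ε^{ord e} to ⟨v, C⟩, while each of the at most m other edges contributes at
-- least -ε^{ord e + 1}; hence ⟨v, C⟩ ≥ ε^{ord e}(1 - mε) > 0.  The vector v need
-- not lie in H₁, so we replace it by its orthogonal projection w onto the span
-- of all cycles: w is a rational combination of cycles, and v - w is orthogonal
-- to every cycle, so ⟨w, C⟩ = ⟨v, C⟩ > 0.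

open import Defs
open import Data.Nat using (ℕ)
open import Data.Fin using (Fin)
open import Data.Fin.Subset using (Subset)
open import Function.Definitions using (Injective)
open import Relation.Binary.PropositionalEquality using (_≡_)

open import Data.Nat as ℕ using (zero; suc; z≤n; s≤s)
import Data.Nat.Properties as ℕP
open import Data.Fin as Fin using (zero; suc)
import Data.Fin.Properties as FinP
import Data.Fin.Subset as Sub
open import Data.Fin.Subset.Properties using (_∈?_)
open import Data.Bool using (true; false; if_then_else_)
open import Data.List using (List; []; _∷_; _++_; map; foldr; allFin; length; lookup; filter; cartesianProduct; cartesianProductWith)
import Data.List.Properties as ListP
open import Data.List.Relation.Unary.All as All using (All; []; _∷_)
import Data.List.Relation.Unary.All.Properties as AllP
open import Data.List.Relation.Unary.Any as Any using (here; there)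
open import Data.List.Relation.Unary.Unique.Propositional using (Unique)
open import Data.List.Relation.Unary.AllPairs using (_∷_)
import Data.List.Relation.Unary.Unique.DecPropositional as UniqueDec
open import Data.List.Membership.Propositional using (_∈_)
open import Data.List.Membership.Propositional.Properties
  using (∈-allFin; ∈-filter⁺; ∈-lookup; ∈-cartesianProduct⁺; ∈-cartesianProductWith⁺)
open import Data.Product using (∃; _×_; _,_; proj₁; proj₂)
open import Data.Unit using (tt)
open import Data.Sum using (inj₁; inj₂)
open import Data.Empty using (⊥-elim)
open import Data.Rational using (ℚ; 0ℚ; 1ℚ; -_; _+_; _*_; _-_; _<_; _≤_; 1/_; _≟_)
import Data.Rational as ℚ
import Data.Rational.Properties as ℚP
open import Data.Rational.Solver using (module +-*-Solver)
open import Relation.Binary.Definitions using (tri<; tri≈; tri>)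
open import Relation.Binary.PropositionalEquality
  using (_≢_; _≗_; refl; sym; trans; cong; cong₂; subst; module ≡-Reasoning)
open import Relation.Nullary using (yes; no; Dec; _×-dec_)
open import Relation.Nullary.Decidable using (⌊_⌋)

open +-*-Solver

-- ∑ xs f is the sum of f x over the list xs; Defs' sumℚ (map f xs) unfolds to it.
∑ : {A : Set} → List A → (A → ℚ) → ℚ
∑ xs f = foldr _+_ 0ℚ (map f xs)

module _ {A : Set} where

  ∑-cong : ∀ (xs : List A) {f g : A → ℚ} → (∀ x → f x ≡ g x) → ∑ xs f ≡ ∑ xs g
  ∑-cong []       f≗g = refl
  ∑-cong (x ∷ xs) f≗g = cong₂ _+_ (f≗g x) (∑-cong xs f≗g)

  ∑-vanish : ∀ (xs : List A) {f : A → ℚ} → All (λ x → f x ≡ 0ℚ) xs → ∑ xs f ≡ 0ℚ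
  ∑-vanish []       []           = refl
  ∑-vanish (x ∷ xs) (fx≡0 ∷ all0) = trans (cong₂ _+_ fx≡0 (∑-vanish xs all0)) (ℚP.+-identityˡ 0ℚ)

  ∑-+ : ∀ (xs : List A) (f g : A → ℚ) → ∑ xs (λ x → f x + g x) ≡ ∑ xs f + ∑ xs g
  ∑-+ []       f g = refl
  ∑-+ (x ∷ xs) f g rewrite ∑-+ xs f g =
    solve 4 (λ a b c d → (a :+ b) :+ (c :+ d) := (a :+ c) :+ (b :+ d)) refl (f x) (g x) (∑ xs f) (∑ xs g)

  ∑-* : ∀ (xs : List A) (c : ℚ) (f : A → ℚ) → ∑ xs (λ x → c * f x) ≡ c * ∑ xs f
  ∑-* []       c f = sym (ℚP.*-zeroʳ c)
  ∑-* (x ∷ xs) c f rewrite ∑-* xs c f = sym (ℚP.*-distribˡ-+ c (f x) (∑ xs f))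

  ∑-++ : ∀ (xs ys : List A) (f : A → ℚ) → ∑ (xs ++ ys) f ≡ ∑ xs f + ∑ ys f
  ∑-++ []       ys f = sym (ℚP.+-identityˡ _)
  ∑-++ (x ∷ xs) ys f rewrite ∑-++ xs ys f = sym (ℚP.+-assoc (f x) _ _)

  ∑-map : ∀ {B : Set} (xs : List B) (g : B → A) (f : A → ℚ) → ∑ (map g xs) f ≡ ∑ xs (λ x → f (g x))
  ∑-map []       g f = refl
  ∑-map (x ∷ xs) g f = cong (f (g x) +_) (∑-map xs g f)

  ∑-nonneg : ∀ (xs : List A) (f : A → ℚ) → (∀ x → 0ℚ ≤ f x) → 0ℚ ≤ ∑ xs f
  ∑-nonneg []       f f≥0 = ℚP.≤-refl
  ∑-nonneg (x ∷ xs) f f≥0 = ℚP.+-mono-≤ (f≥0 x) (∑-nonneg xs f f≥0)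

  ∑-nonneg-zero : ∀ (xs : List A) (f : A → ℚ) → (∀ x → 0ℚ ≤ f x) → ∑ xs f ≡ 0ℚ →
                  All (λ x → f x ≡ 0ℚ) xs
  ∑-nonneg-zero []       f f≥0 sum≡0 = []
  ∑-nonneg-zero (x ∷ xs) f f≥0 sum≡0 =
    first-zero (f≥0 x) (∑-nonneg xs f f≥0) sum≡0
    ∷ ∑-nonneg-zero xs f f≥0 (first-zero (∑-nonneg xs f f≥0) (f≥0 x) (trans (ℚP.+-comm _ (f x)) sum≡0))
    where
    first-zero : ∀ {a b} → 0ℚ ≤ a → 0ℚ ≤ b → a + b ≡ 0ℚ → a ≡ 0ℚ
    first-zero {a} {b} a≥0 b≥0 a+b≡0 = ℚP.≤-antisym
      (ℚP.≤-trans (ℚP.≤-reflexive (sym (ℚP.+-identityʳ a)))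
        (ℚP.≤-trans (ℚP.+-monoʳ-≤ a b≥0) (ℚP.≤-reflexive a+b≡0)))
      a≥0

∑-allFin-suc : ∀ {k} (f : Fin (suc k) → ℚ) → ∑ (allFin (suc k)) f ≡ f zero + ∑ (allFin k) (λ e → f (suc e))
∑-allFin-suc {k} f = cong (λ xs → f zero + foldr _+_ 0ℚ xs)
  (trans (ListP.map-tabulate suc f) (sym (ListP.map-tabulate (λ e → e) (λ e → f (suc e)))))

∑-point : ∀ {k} (x : Fin k) (f : Fin k → ℚ) → (∀ e → e ≢ x → f e ≡ 0ℚ) → ∑ (allFin k) f ≡ f x
∑-point {suc k} zero f vanishes = begin
  ∑ (allFin (suc k)) f                      ≡⟨ ∑-allFin-suc f ⟩
  f zero + ∑ (allFin k) (λ e → f (suc e))   ≡⟨ cong (f zero +_) (∑-vanish (allFin k) (All.universal (λ e → vanishes (suc e) λ ()) _)) ⟩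
  f zero + 0ℚ                               ≡⟨ ℚP.+-identityʳ (f zero) ⟩
  f zero                                    ∎
  where open ≡-Reasoning
∑-point {suc k} (suc x) f vanishes = begin
  ∑ (allFin (suc k)) f                      ≡⟨ ∑-allFin-suc f ⟩
  f zero + ∑ (allFin k) (λ e → f (suc e))   ≡⟨ cong₂ _+_ (vanishes zero λ ()) (∑-point x (λ e → f (suc e)) λ e e≢x → vanishes (suc e) (λ eq → e≢x (FinP.suc-injective eq))) ⟩
  0ℚ + f (suc x)                            ≡⟨ ℚP.+-identityˡ (f (suc x)) ⟩
  f (suc x)                                 ∎
  where open ≡-Reasoning

square-nonneg : ∀ x → 0ℚ ≤ x * x
square-nonneg x with ℚP.≤-total 0ℚ x
... | inj₁ x≥0 = ℚP.nonNegative⁻¹ _ {{ℚP.nonNeg*nonNeg⇒nonNeg x {{ℚ.nonNegative x≥0}} x {{ℚ.nonNegative x≥0}}}}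
... | inj₂ x≤0 = ℚP.nonNegative⁻¹ _ {{ℚP.nonPos*nonPos⇒nonPos x {{ℚ.nonPositive x≤0}} x {{ℚ.nonPositive x≤0}}}}

-- ℚ has no nonzero nilpotents: a nonzero square is positive.
square-zero : ∀ x → x * x ≡ 0ℚ → x ≡ 0ℚ
square-zero x x²≡0 with ℚP.<-cmp x 0ℚ
... | tri< x<0 _ _ = ⊥-elim (ℚP.<-irrefl (sym x²≡0)
        (ℚP.positive⁻¹ _ {{ℚP.neg*neg⇒pos x {{ℚ.negative x<0}} x {{ℚ.negative x<0}}}}))
... | tri≈ _ x≡0 _ = x≡0
... | tri> _ _ x>0 = ⊥-elim (ℚP.<-irrefl (sym x²≡0)
        (ℚP.positive⁻¹ _ {{ℚP.pos*pos⇒pos x {{ℚ.positive x>0}} x {{ℚ.positive x>0}}}}))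

*-pos : ∀ {a b} → 0ℚ < a → 0ℚ < b → 0ℚ < a * b
*-pos {a} {b} a>0 b>0 = ℚP.positive⁻¹ (a * b) {{ℚP.pos*pos⇒pos a {{ℚ.positive a>0}} b {{ℚ.positive b>0}}}}

infixr 8 _×ℚ_
_×ℚ_ : ℕ → ℚ → ℚ
zero  ×ℚ q = 0ℚ
suc n ×ℚ q = q + n ×ℚ q

×ℚ-nonneg : ∀ n {q} → 0ℚ ≤ q → 0ℚ ≤ n ×ℚ q
×ℚ-nonneg zero    q≥0 = ℚP.≤-refl
×ℚ-nonneg (suc n) q≥0 = ℚP.+-mono-≤ q≥0 (×ℚ-nonneg n q≥0)

×ℚ-mono : ∀ {n n'} {q} → n ℕ.≤ n' → 0ℚ ≤ q → n ×ℚ q ≤ n' ×ℚ q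
×ℚ-mono {n' = n'} z≤n     q≥0 = ×ℚ-nonneg n' q≥0
×ℚ-mono {q = q}   (s≤s le) q≥0 = ℚP.+-monoʳ-≤ q (×ℚ-mono le q≥0)

×ℚ-as-* : ∀ n q → n ×ℚ q ≡ (n ×ℚ 1ℚ) * q
×ℚ-as-* zero    q = sym (ℚP.*-zeroˡ q)
×ℚ-as-* (suc n) q rewrite ×ℚ-as-* n q =
  solve 2 (λ q r → q :+ r :* q := (con 1ℚ :+ r) :* q) refl q (n ×ℚ 1ℚ)

module InnerProduct (m : ℕ) where

  V : Set
  V = Fin m → ℚ

  dot : V → V → ℚ
  dot x y = ∑ (allFin m) (λ e → x e * y e)

  infixl 6 _-ᵥ_
  infixl 7 _·ᵥ_

  _-ᵥ_ : V → V → V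
  (x -ᵥ y) e = x e - y e

  _·ᵥ_ : ℚ → V → V
  (t ·ᵥ x) e = t * x e

  dot-congˡ : ∀ {x x'} y → x ≗ x' → dot x y ≡ dot x' y
  dot-congˡ y x≗x' = ∑-cong (allFin m) (λ e → cong (_* y e) (x≗x' e))

  dot-congʳ : ∀ x {y y'} → y ≗ y' → dot x y ≡ dot x y'
  dot-congʳ x y≗y' = ∑-cong (allFin m) (λ e → cong (x e *_) (y≗y' e))

  dot-zeroʳ : ∀ x {y} → (∀ e → y e ≡ 0ℚ) → dot x y ≡ 0ℚ
  dot-zeroʳ x y≡0 = ∑-vanish (allFin m) (All.universal (λ e → trans (cong (x e *_) (y≡0 e)) (ℚP.*-zeroʳ (x e))) _)

  dot-+ʳ : ∀ x y z → dot x (λ e → y e + z e) ≡ dot x y + dot x z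
  dot-+ʳ x y z = trans (∑-cong (allFin m) (λ e → ℚP.*-distribˡ-+ (x e) (y e) (z e)))
                       (∑-+ (allFin m) (λ e → x e * y e) (λ e → x e * z e))

  dot-·ʳ : ∀ x t y → dot x (t ·ᵥ y) ≡ t * dot x y
  dot-·ʳ x t y = trans (∑-cong (allFin m) (λ e → solve 3 (λ a t b → a :* (t :* b) := t :* (a :* b)) refl (x e) t (y e)))
                       (∑-* (allFin m) t (λ e → x e * y e))

  dot-linearˡ : ∀ x t y z → dot (x -ᵥ t ·ᵥ y) z ≡ dot x z - t * dot y z
  dot-linearˡ x t y z = begin
    dot (x -ᵥ t ·ᵥ y) z
      ≡⟨ ∑-cong (allFin m) (λ e → solve 4 (λ a t b c → (a :- t :* b) :* c := a :* c :+ (:- t) :* (b :* c)) refl (x e) t (y e) (z e)) ⟩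
    ∑ (allFin m) (λ e → x e * z e + (- t) * (y e * z e))
      ≡⟨ ∑-+ (allFin m) (λ e → x e * z e) (λ e → (- t) * (y e * z e)) ⟩
    dot x z + ∑ (allFin m) (λ e → (- t) * (y e * z e))
      ≡⟨ cong (dot x z +_) (∑-* (allFin m) (- t) (λ e → y e * z e)) ⟩
    dot x z + (- t) * dot y z
      ≡⟨ solve 3 (λ a t b → a :+ (:- t) :* b := a :- t :* b) refl (dot x z) t (dot y z) ⟩
    dot x z - t * dot y z ∎
    where open ≡-Reasoning

  dot-subˡ : ∀ x y z → dot (x -ᵥ y) z ≡ dot x z - dot y z
  dot-subˡ x y z = begin
    dot (x -ᵥ y) z            ≡⟨ dot-congˡ z (λ e → cong (_-_ (x e)) (sym (ℚP.*-identityˡ (y e)))) ⟩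
    dot (x -ᵥ 1ℚ ·ᵥ y) z      ≡⟨ dot-linearˡ x 1ℚ y z ⟩
    dot x z - 1ℚ * dot y z    ≡⟨ cong (_-_ (dot x z)) (ℚP.*-identityˡ (dot y z)) ⟩
    dot x z - dot y z         ∎
    where open ≡-Reasoning

  dot-self-zero : ∀ x → dot x x ≡ 0ℚ → ∀ e → x e ≡ 0ℚ
  dot-self-zero x ⟨x,x⟩≡0 e = square-zero (x e)
    (All.lookup (∑-nonneg-zero (allFin m) (λ e → x e * x e) (λ e → square-nonneg (x e)) ⟨x,x⟩≡0) (∈-allFin e))

  dot-point : ∀ x (i : Fin m) (c : ℚ) → dot x (λ e → if ⌊ i Fin.≟ e ⌋ then c else 0ℚ) ≡ x i * c
  dot-point x i c = trans (∑-point i _ off-i) at-i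
    where
    off-i : ∀ e → e ≢ i → x e * (if ⌊ i Fin.≟ e ⌋ then c else 0ℚ) ≡ 0ℚ
    off-i e e≢i with i Fin.≟ e
    ... | yes i≡e = ⊥-elim (e≢i (sym i≡e))
    ... | no _    = ℚP.*-zeroʳ (x e)
    at-i : x i * (if ⌊ i Fin.≟ i ⌋ then c else 0ℚ) ≡ x i * c
    at-i with i Fin.≟ i
    ... | yes _   = refl
    ... | no i≢i  = ⊥-elim (i≢i refl)

-- Orthogonal projection onto the span of finitely many vectors
--
-- The vectors are indexed by a type X through vec : X → ℚ^m; a combination is
-- a list of (coefficient, index) pairs.

module Projection {m : ℕ} {X : Set} (vec : X → Fin m → ℚ) where
  open InnerProduct m

  comb : List (ℚ × X) → V
  comb L e = ∑ L (λ p → proj₁ p * vec (proj₂ p) e)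

  Over : List X → List (ℚ × X) → Set
  Over Ds L = All (λ p → proj₂ p ∈ Ds) L

  _⊥_ : V → List X → Set
  x ⊥ Ds = All (λ D → dot x (vec D) ≡ 0ℚ) Ds

  comb-++ : ∀ L₁ L₂ e → comb (L₁ ++ L₂) e ≡ comb L₁ e + comb L₂ e
  comb-++ L₁ L₂ e = ∑-++ L₁ L₂ _

  comb-scale : ∀ t L e → comb (map (λ p → (t * proj₁ p , proj₂ p)) L) e ≡ t * comb L e
  comb-scale t L e = trans (∑-map L _ _)
    (trans (∑-cong L (λ p → ℚP.*-assoc t (proj₁ p) (vec (proj₂ p) e))) (∑-* L t _))

  dot-comb : ∀ x L → dot x (comb L) ≡ ∑ L (λ p → proj₁ p * dot x (vec (proj₂ p)))
  dot-comb x []            = dot-zeroʳ x (λ e → refl)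
  dot-comb x ((t , D) ∷ L) = begin
    dot x (comb ((t , D) ∷ L))           ≡⟨ dot-+ʳ x (t ·ᵥ vec D) (comb L) ⟩
    dot x (t ·ᵥ vec D) + dot x (comb L)   ≡⟨ cong₂ _+_ (dot-·ʳ x t (vec D)) (dot-comb x L) ⟩
    t * dot x (vec D) + ∑ L (λ p → proj₁ p * dot x (vec (proj₂ p))) ∎
    where open ≡-Reasoning

  ⊥-comb : ∀ x {Ds L} → x ⊥ Ds → Over Ds L → dot x (comb L) ≡ 0ℚ
  ⊥-comb x {L = L} x⊥Ds L-over = trans (dot-comb x L)
    (∑-vanish L (All.map (λ {p} p∈Ds → trans (cong (proj₁ p *_) (All.lookup x⊥Ds p∈Ds)) (ℚP.*-zeroʳ (proj₁ p))) L-over))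

  ⊥-residual : ∀ x D {Ds L} → x ⊥ Ds → Over Ds L → dot x (vec D) ≡ dot x (vec D -ᵥ comb L)
  ⊥-residual x D {L = L} x⊥Ds L-over = begin
    dot x (vec D)                                  ≡⟨ dot-congʳ x (λ e → solve 2 (λ a b → a := (a :- b) :+ b) refl (vec D e) (comb L e)) ⟩
    dot x (λ e → (vec D -ᵥ comb L) e + comb L e)    ≡⟨ dot-+ʳ x (vec D -ᵥ comb L) (comb L) ⟩
    dot x (vec D -ᵥ comb L) + dot x (comb L)        ≡⟨ cong (dot x (vec D -ᵥ comb L) +_) (⊥-comb x x⊥Ds L-over) ⟩
    dot x (vec D -ᵥ comb L) + 0ℚ                   ≡⟨ ℚP.+-identityʳ _ ⟩
    dot x (vec D -ᵥ comb L)                        ∎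
    where open ≡-Reasoning

  ⊥-resp : ∀ {x} x' {Ds} → x ≗ x' → x ⊥ Ds → x' ⊥ Ds
  ⊥-resp x' x≗x' = All.map (λ {D} ⟨x,D⟩≡0 → trans (sym (dot-congˡ (vec D) x≗x')) ⟨x,D⟩≡0)

  ⊥-combine : ∀ x y t {Ds} → x ⊥ Ds → y ⊥ Ds → (x -ᵥ t ·ᵥ y) ⊥ Ds
  ⊥-combine x y t x⊥Ds y⊥Ds = All.zipWith
    (λ { {D} (⟨x,D⟩≡0 , ⟨y,D⟩≡0) → trans (dot-linearˡ x t y (vec D))
           (trans (cong₂ (λ a b → a - t * b) ⟨x,D⟩≡0 ⟨y,D⟩≡0) (cong (_-_ 0ℚ) (ℚP.*-zeroʳ t))) })
    (x⊥Ds , y⊥Ds)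

  Projects : V → List X → Set
  Projects v Ds = ∃ λ L → Over Ds L × (v -ᵥ comb L) ⊥ Ds

  -- One Gram–Schmidt step.  Given projections of v (residual r) and of vec D
  -- (residual D') onto the span of Ds, subtract from r its component along D'.
  module GramSchmidtStep {Ds : List X} (D : X) (v : V) (L₁ L₂ : List (ℚ × X))
                         (over₁ : Over Ds L₁) (over₂ : Over Ds L₂)
                         (r⊥Ds : (v -ᵥ comb L₁) ⊥ Ds) (D'⊥Ds : (vec D -ᵥ comb L₂) ⊥ Ds) where
    r D' : V
    r  = v -ᵥ comb L₁
    D' = vec D -ᵥ comb L₂

    -- The combination with residual r - t·D': it adds t·D' = t·(D - comb L₂) to L₁.
    combination : ℚ → List (ℚ × X)
    combination t = L₁ ++ ((t , D) ∷ map (λ p → (- t * proj₁ p , proj₂ p)) L₂)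

    combination-over : ∀ t → Over (D ∷ Ds) (combination t)
    combination-over t = AllP.++⁺ (All.map there over₁) (here refl ∷ AllP.map⁺ (All.map there over₂))

    combination-residual : ∀ t → r -ᵥ t ·ᵥ D' ≗ v -ᵥ comb (combination t)
    combination-residual t e = begin
      v e - comb L₁ e - t * (vec D e - comb L₂ e)
        ≡⟨ solve 5 (λ v c t d c₂ → v :- c :- t :* (d :- c₂) := v :- (c :+ (t :* d :+ (:- t) :* c₂))) refl (v e) (comb L₁ e) t (vec D e) (comb L₂ e) ⟩
      v e - (comb L₁ e + (t * vec D e + (- t) * comb L₂ e))
        ≡⟨ cong (λ z → v e - (comb L₁ e + (t * vec D e + z))) (sym (comb-scale (- t) L₂ e)) ⟩
      v e - (comb L₁ e + comb ((t , D) ∷ map (λ p → (- t * proj₁ p , proj₂ p)) L₂) e)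
        ≡⟨ cong (_-_ (v e)) (sym (comb-++ L₁ _ e)) ⟩
      v e - comb (combination t) e ∎
      where open ≡-Reasoning

    -- If D' = 0, D already lies in the span of Ds and L₁ still projects v.
    degenerate : dot D' D' ≡ 0ℚ → Projects v (D ∷ Ds)
    degenerate ⟨D',D'⟩≡0 =
      L₁ , All.map there over₁ ,
      trans (⊥-residual r D r⊥Ds over₂) (dot-zeroʳ r (dot-self-zero D' ⟨D',D'⟩≡0)) ∷ r⊥Ds

    -- Otherwise t = ⟨r, D'⟩ / ⟨D', D'⟩ makes r - t·D' orthogonal to D' and hence to D.
    generic : dot D' D' ≢ 0ℚ → Projects v (D ∷ Ds)
    generic ⟨D',D'⟩≢0 = combination t , combination-over t , ⟨r',D⟩≡0 ∷ r'⊥Ds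
      where
      instance
        D'-nonzero : ℚ.NonZero (dot D' D')
        D'-nonzero = ℚ.≢-nonZero ⟨D',D'⟩≢0
      t : ℚ
      t = dot r D' * 1/ (dot D' D')
      r' : V
      r' = v -ᵥ comb (combination t)
      r'⊥Ds : r' ⊥ Ds
      r'⊥Ds = ⊥-resp r' (combination-residual t) (⊥-combine r D' t r⊥Ds D'⊥Ds)
      ⟨r',D⟩≡0 : dot r' (vec D) ≡ 0ℚ
      ⟨r',D⟩≡0 = begin
        dot r' (vec D)                 ≡⟨ ⊥-residual r' D r'⊥Ds over₂ ⟩
        dot r' D'                      ≡⟨ dot-congˡ D' (λ e → sym (combination-residual t e)) ⟩
        dot (r -ᵥ t ·ᵥ D') D'          ≡⟨ dot-linearˡ r t D' D' ⟩
        dot r D' - t * dot D' D'       ≡⟨ solve 3 (λ a y n → a :- (a :* y) :* n := a :- a :* (n :* y)) refl (dot r D') (1/ dot D' D') (dot D' D') ⟩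
        dot r D' - dot r D' * (dot D' D' * 1/ dot D' D')  ≡⟨ cong (λ z → dot r D' - dot r D' * z) (ℚP.*-inverseʳ (dot D' D')) ⟩
        dot r D' - dot r D' * 1ℚ      ≡⟨ solve 1 (λ a → a :- a :* con 1ℚ := con 0ℚ) refl (dot r D') ⟩
        0ℚ                            ∎
        where open ≡-Reasoning

    step : Projects v (D ∷ Ds)
    step with dot D' D' ≟ 0ℚ
    ... | yes ⟨D',D'⟩≡0 = degenerate ⟨D',D'⟩≡0
    ... | no  ⟨D',D'⟩≢0 = generic ⟨D',D'⟩≢0

  project : ∀ Ds v → Projects v Ds
  project []       v = [] , [] , []
  project (D ∷ Ds) v with project Ds v | project Ds (vec D)
  ... | L₁ , over₁ , r⊥Ds | L₂ , over₂ , D'⊥Ds = GramSchmidtStep.step D v L₁ L₂ over₁ over₂ r⊥Ds D'⊥Ds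

  project-dot : ∀ v L {Ds} → (v -ᵥ comb L) ⊥ Ds → ∀ {D} → D ∈ Ds → dot (comb L) (vec D) ≡ dot v (vec D)
  project-dot v L res⊥Ds {D} D∈Ds = begin
    dot (comb L) (vec D)                                      ≡⟨ solve 2 (λ a b → b := a :- (a :- b)) refl (dot v (vec D)) (dot (comb L) (vec D)) ⟩
    dot v (vec D) - (dot v (vec D) - dot (comb L) (vec D))     ≡⟨ cong (_-_ (dot v (vec D))) residual-zero ⟩
    dot v (vec D) - 0ℚ                                        ≡⟨ ℚP.+-identityʳ (dot v (vec D)) ⟩
    dot v (vec D)                                             ∎
    where
    open ≡-Reasoning
    residual-zero : dot v (vec D) - dot (comb L) (vec D) ≡ 0ℚ
    residual-zero = trans (sym (dot-subˡ v (comb L) (vec D))) (All.lookup res⊥Ds D∈Ds)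

words : {A : Set} → List A → ℕ → List (List A)
words as zero    = [] ∷ []
words as (suc k) = [] ∷ cartesianProductWith _∷_ as (words as k)

∈-words : ∀ {A : Set} {as : List A} → (∀ a → a ∈ as) → ∀ k xs → length xs ℕ.≤ k → xs ∈ words as k
∈-words all∈ zero    []       _         = here refl
∈-words all∈ (suc k) []       _         = here refl
∈-words all∈ (suc k) (x ∷ xs) (s≤s len) = there (∈-cartesianProductWith⁺ _∷_ (all∈ x) (∈-words all∈ k xs len))

lookup-injective : ∀ {A : Set} {xs : List A} → Unique xs → Injective _≡_ _≡_ (lookup xs)
lookup-injective {xs = x ∷ xs} (x∉xs ∷ uniq) {zero}  {zero}  _  = refl
lookup-injective {xs = x ∷ xs} (x∉xs ∷ uniq) {zero}  {suc j} eq = ⊥-elim (All.lookup x∉xs (∈-lookup j) eq)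
lookup-injective {xs = x ∷ xs} (x∉xs ∷ uniq) {suc i} {zero}  eq = ⊥-elim (All.lookup x∉xs (∈-lookup i) (sym eq))
lookup-injective {xs = x ∷ xs} (x∉xs ∷ uniq) {suc i} {suc j} eq = cong suc (lookup-injective uniq eq)

unique-length : ∀ {k} {xs : List (Fin k)} → Unique xs → length xs ℕ.≤ k
unique-length uniq = FinP.injective⇒≤ (lookup-injective uniq)

module Cycles (G : Graph) where
  open Graph G
  open InnerProduct m

  -- Being a cycle is decidable, so cycles can be filtered out of a finite list of candidates.
  chain? : ∀ ss → Dec (Chain G ss)
  chain? []           = yes tt
  chain? (s ∷ [])     = yes tt
  chain? (s ∷ t ∷ ss) = (stepHead G s Fin.≟ stepTail G t) ×-dec chain? (t ∷ ss)

  isCycle? : ∀ C → Dec (IsCycle G C)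
  isCycle? []       = no λ ()
  isCycle? (s ∷ ss) =
    (2 ℕ.≤? length (s ∷ ss)) ×-dec (chain? _ ×-dec (UniqueDec.unique? Fin._≟_ _ ×-dec UniqueDec.unique? Fin._≟_ _))

  cycle-distinct-edges : ∀ C → IsCycle G C → Unique (map proj₁ C)
  cycle-distinct-edges (s ∷ ss) (_ , _ , _ , distinct) = distinct

  cycle-length : ∀ C → IsCycle G C → length C ℕ.≤ m
  cycle-length C isC = subst (ℕ._≤ m) (ListP.length-map proj₁ C) (unique-length (cycle-distinct-edges C isC))

  steps : List (Step G)
  steps = cartesianProduct (allFin m) (true ∷ false ∷ [])

  ∈-steps : ∀ s → s ∈ steps
  ∈-steps (e , true)  = ∈-cartesianProduct⁺ (∈-allFin e) (here refl)
  ∈-steps (e , false) = ∈-cartesianProduct⁺ (∈-allFin e) (there (here refl))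

  -- Every cycle has at most m steps, so it occurs among the step words of length ≤ m.
  cycles : List (List (Step G))
  cycles = filter isCycle? (words steps m)

  ∈-cycles : ∀ C → IsCycle G C → C ∈ cycles
  ∈-cycles C isC = ∈-filter⁺ isCycle? (∈-words ∈-steps m C (cycle-length C isC)) isC

  cycles-are-cycles : All (IsCycle G) cycles
  cycles-are-cycles = AllP.all-filter isCycle? (words steps m)

  dot-cycleVec : ∀ (v : Fin m → ℚ) C →
                 dot v (cycleVec G C) ≡ ∑ C (λ s → v (proj₁ s) * signℚ G (proj₂ s))
  dot-cycleVec v []      = dot-zeroʳ v (λ e → refl)
  dot-cycleVec v (s ∷ C) = trans (dot-+ʳ v _ (cycleVec G C))
                                 (cong₂ _+_ (dot-point v (proj₁ s) (signℚ G (proj₂ s))) (dot-cycleVec v C))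

module Peak {A B : Set} (key : A → B) (f : A → ℚ) {q : ℚ} (q≥0 : 0ℚ ≤ q) where
  open ℚP.≤-Reasoning

  ∑-lower : ∀ ys → All (λ y → - q ≤ f y) ys → - (length ys ×ℚ q) ≤ ∑ ys f
  ∑-lower []       []              = ℚP.≤-refl
  ∑-lower (y ∷ ys) (fy≥-q ∷ bounds) = begin
    - (q + length ys ×ℚ q)      ≡⟨ ℚP.neg-distrib-+ q (length ys ×ℚ q) ⟩
    - q + - (length ys ×ℚ q)    ≤⟨ ℚP.+-mono-≤ fy≥-q (∑-lower ys bounds) ⟩
    f y + ∑ ys f                ∎

  ∑-peak : ∀ {x} xs → x ∈ xs → Unique (map key xs) → All (λ y → key y ≢ key x → - q ≤ f y) xs →
           f x - length xs ×ℚ q ≤ ∑ xs f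
  ∑-peak {x} (x ∷ ys) (here refl) (x-fresh ∷ _) (_ ∷ bounds) = begin
    f x - (q + n)       ≤⟨ ℚP.+-monoʳ-≤ (f x) (ℚP.neg-antimono-≤ n≤q+n) ⟩
    f x - n             ≤⟨ ℚP.+-monoʳ-≤ (f x) (∑-lower ys others) ⟩
    f x + ∑ ys f        ∎
    where
    n = length ys ×ℚ q
    n≤q+n : n ≤ q + n
    n≤q+n = ℚP.≤-trans (ℚP.≤-reflexive (sym (ℚP.+-identityˡ n))) (ℚP.+-monoˡ-≤ n q≥0)
    others : All (λ y → - q ≤ f y) ys
    others = All.zipWith (λ (x≢y , bound) → bound (λ y≡x → x≢y (sym y≡x))) (AllP.map⁻ x-fresh , bounds)
  ∑-peak {x} (y ∷ ys) (there x∈ys) (y-fresh ∷ distinct) (bound ∷ bounds) = begin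
    f x - (q + n)       ≡⟨ solve 3 (λ a q n → a :- (q :+ n) := (:- q) :+ (a :- n)) refl (f x) q n ⟩
    - q + (f x - n)     ≤⟨ ℚP.+-mono-≤ (bound (All.lookup (AllP.map⁻ y-fresh) x∈ys)) (∑-peak ys x∈ys distinct bounds) ⟩
    f y + ∑ ys f        ∎
    where n = length ys ×ℚ q

-- The dominant weight vector
--
-- Edges of F get weight 0 and an edge e outside F gets weight ε^{ord e}, with
-- ε = 1/(1+m) so small that m edges of weight at most ε^{a+1} cannot outweigh
-- one edge of weight ε^a.

module DominantWeight (G : Graph) (F : Subset (Graph.m G)) (ord : Fin (Graph.m G) → ℕ)
                      (ord-injective : Injective _≡_ _≡_ ord) where
  open Graph G using (m)
  open Peak

  N : ℚ
  N = 1ℚ + m ×ℚ 1ℚ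

  1≤N : 1ℚ ≤ N
  1≤N = ℚP.≤-trans (ℚP.≤-reflexive (sym (ℚP.+-identityʳ 1ℚ))) (ℚP.+-monoʳ-≤ 1ℚ (×ℚ-nonneg m (ℚP.<⇒≤ (ℚP.positive⁻¹ 1ℚ))))

  N>0 : 0ℚ < N
  N>0 = ℚP.<-≤-trans (ℚP.positive⁻¹ 1ℚ) 1≤N

  instance
    N-nonzero : ℚ.NonZero N
    N-nonzero = ℚ.>-nonZero N>0

  ε : ℚ
  ε = 1/ N

  ε>0 : 0ℚ < ε
  ε>0 = ℚP.positive⁻¹ ε {{ℚP.1/pos⇒pos N {{ℚ.positive N>0}}}}

  ε≤1 : ε ≤ 1ℚ
  ε≤1 = ℚP.≤-trans (ℚP.≤-reflexive (sym (ℚP.*-identityʳ ε)))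
          (ℚP.≤-trans (ℚP.*-monoˡ-≤-nonNeg ε {{ℚ.nonNegative (ℚP.<⇒≤ ε>0)}} 1≤N) (ℚP.≤-reflexive (ℚP.*-inverseˡ N)))

  power : ℕ → ℚ
  power zero    = 1ℚ
  power (suc k) = ε * power k

  power>0 : ∀ k → 0ℚ < power k
  power>0 zero    = ℚP.positive⁻¹ 1ℚ
  power>0 (suc k) = *-pos ε>0 (power>0 k)

  power-antitone : ∀ {k l} → k ℕ.≤′ l → power l ≤ power k
  power-antitone ℕ.≤′-refl             = ℚP.≤-refl
  power-antitone {l = suc l} (ℕ.≤′-step k≤l) = ℚP.≤-trans power-step (power-antitone k≤l)
    where
    power-step : ε * power l ≤ power l
    power-step = ℚP.≤-trans (ℚP.*-monoʳ-≤-nonNeg (power l) {{ℚ.nonNegative (ℚP.<⇒≤ (power>0 l))}} ε≤1)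
                            (ℚP.≤-reflexive (ℚP.*-identityˡ (power l)))

  dominance : ∀ a → power a - m ×ℚ power (suc a) ≡ power (suc a)
  dominance a = begin
    P - m ×ℚ (ε * P)              ≡⟨ cong (_-_ P) (×ℚ-as-* m (ε * P)) ⟩
    P - M * (ε * P)               ≡⟨ cong (λ z → z - M * (ε * P)) (sym (trans (cong (P *_) (ℚP.*-inverseˡ N)) (ℚP.*-identityʳ P))) ⟩
    P * (ε * N) - M * (ε * P)     ≡⟨ solve 3 (λ P ε M → P :* (ε :* (con 1ℚ :+ M)) :- M :* (ε :* P) := ε :* P) refl P ε M ⟩
    ε * P                         ∎
    where
    open ≡-Reasoning
    P = power a
    M = m ×ℚ 1ℚ

  weight : Fin m → ℚ
  weight e with e ∈? F
  ... | yes _ = 0ℚ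
  ... | no  _ = power (ord e)

  weight-nonneg : ∀ e → 0ℚ ≤ weight e
  weight-nonneg e with e ∈? F
  ... | yes _ = ℚP.≤-refl
  ... | no  _ = ℚP.<⇒≤ (power>0 (ord e))

  weight-free : ∀ e → e Sub.∉ F → weight e ≡ power (ord e)
  weight-free e e∉F with e ∈? F
  ... | yes e∈F = ⊥-elim (e∉F e∈F)
  ... | no  _   = refl

  weight-beyond : ∀ e e' → e' ≢ e → (e' Sub.∉ F → ord e ℕ.≤ ord e') → weight e' ≤ power (suc (ord e))
  weight-beyond e e' e'≢e not-smaller with e' ∈? F
  ... | yes _    = ℚP.<⇒≤ (power>0 (suc (ord e)))
  ... | no e'∉F  = power-antitone (ℕP.≤⇒≤′ (ℕP.≤∧≢⇒< (not-smaller e'∉F) (λ eq → e'≢e (sym (ord-injective eq)))))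

  term : Step G → ℚ
  term s = weight (proj₁ s) * signℚ G (proj₂ s)

  flow : List (Step G) → ℚ
  flow C = ∑ C term

  sign-lower : ∀ x b → 0ℚ ≤ x → - x ≤ x * signℚ G b
  sign-lower x true  x≥0 = ℚP.≤-trans (ℚP.neg-antimono-≤ x≥0) (ℚP.≤-trans x≥0 (ℚP.≤-reflexive (sym (ℚP.*-identityʳ x))))
  sign-lower x false x≥0 = ℚP.≤-reflexive (solve 1 (λ x → :- x := x :* (:- con 1ℚ)) refl x)

  flow-positive : ∀ C → Unique (map proj₁ C) → MinEdgeForward G F ord C → 0ℚ < flow C
  flow-positive C distinct (e , e∉F , e∈C , minimal) = begin-strict
    0ℚ                            <⟨ power>0 (suc a) ⟩
    q                             ≡⟨ sym (dominance a) ⟩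
    power a - m ×ℚ q              ≤⟨ ℚP.+-monoʳ-≤ (power a) (ℚP.neg-antimono-≤ (×ℚ-mono length≤m q≥0)) ⟩
    power a - length C ×ℚ q       ≡⟨ cong (λ z → z - length C ×ℚ q) (sym forward-term) ⟩
    term (e , true) - length C ×ℚ q ≤⟨ ∑-peak proj₁ term q≥0 C (Any.map sym e∈C) distinct bounds ⟩
    flow C                        ∎
    where
    open ℚP.≤-Reasoning
    a = ord e
    q = power (suc a)
    q≥0 : 0ℚ ≤ q
    q≥0 = ℚP.<⇒≤ (power>0 (suc a))
    length≤m : length C ℕ.≤ m
    length≤m = subst (ℕ._≤ m) (ListP.length-map proj₁ C) (unique-length distinct)
    forward-term : term (e , true) ≡ power a
    forward-term = trans (cong (_* 1ℚ) (weight-free e e∉F)) (ℚP.*-identityʳ (power a))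
    bounds : All (λ s → proj₁ s ≢ e → - q ≤ term s) C
    bounds = All.map (λ {s} not-smaller s≢e →
               ℚP.≤-trans (ℚP.neg-antimono-≤ (weight-beyond e (proj₁ s) s≢e not-smaller))
                          (sign-lower (weight (proj₁ s)) (proj₂ s) (weight-nonneg (proj₁ s))))
             minimal

theorem4p1 : (G : Graph) → Connected G → (F : Subset (Graph.m G)) → IsForest G F →
    (ord : Fin (Graph.m G) → ℕ) → Injective _≡_ _≡_ ord →
    Geometric G F ord
theorem4p1 G _ F _ ord ord-injective = w , (L , L-cycles , λ e → refl) , positive
  where
  open Cycles G
  open DominantWeight G F ord ord-injective
  open InnerProduct (Graph.m G)
  open Projection (cycleVec G)

  projection : Projects weight cycles
  projection = project cycles weight

  L : List (ℚ × List (Step G))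
  L = proj₁ projection

  w : V
  w = comb L

  L-cycles : All (λ p → IsCycle G (proj₂ p)) L
  L-cycles = All.map (All.lookup cycles-are-cycles) (proj₁ (proj₂ projection))

  -- ⟨w, C⟩ = ⟨weight, C⟩ = flow C > 0 for every cycle C oriented as in the theorem.
  positive : ∀ C → IsCycle G C → MinEdgeForward G F ord C → 0ℚ < dot w (cycleVec G C)
  positive C isC minimal-forward = subst (0ℚ <_)
    (sym (trans (project-dot weight L (proj₂ (proj₂ projection)) (∈-cycles C isC)) (dot-cycleVec weight C)))
    (flow-positive C (cycle-distinct-edges C isC) minimal-forward)
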